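{- Let $n,k$ be positive integers with $n\ge 2k$ and let $\ell\ge 2$ be an integer. Then the graphs $Q(n,k)$ and $Q(\ell n,\ell k)$ are isomorphic.
   Context: For a positive integer $n$ let $[n]=\{1,\dots,n\}$ and let $C_n$ be the cycle on $[n]$ with edges $\{i,i+1\}$ ($1\le i\le n-1$) and $\{n,1\}$. The Schrijver graph $\mathrm{SG}(n,k)$ ($n\ge 2k$) has as vertices the $k$-subsets of $[n]$ containing no two cyclically consecutive elements, two vertices adjacent iff they are disjoint. An arc of $C_n$ is a set $\{i,i+1,\dots,i+m-1\}$ (addition mod $n$) with $1\le m\le n-1$. A set $U\subseteq[n]$ is well-spread if for any two arcs $A,B$ with $|A|=|B|$ we have $\big||A\cap U|-|B\cap U|\big|\le 1$. $Q(n,k)$ is the induced subgraph of $\mathrm{SG}(n,k)$ on all well-spread $k$-subsets of $[n]$. -}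

module Defs where

open import Data.Nat using (ℕ; zero; suc; _+_; _∸_; _≤_; _<_)
open import Data.Nat.DivMod using (_mod_)
open import Data.Bool using (Bool; true; false; if_then_else_)
open import Data.Fin using (Fin)
open import Data.Fin.Subset using (Subset; ∣_∣; _∩_; ⊥)
open import Data.Vec using (lookup)
open import Data.Product using (Σ; _×_; proj₁)
open import Relation.Binary.PropositionalEquality using (_≡_)
open import Relation.Nullary using (¬_)

-- The ground set [n] is modelled as Fin n = {0,…,n-1} (element i+1 of the
-- paper corresponds to i).  A subset of [n] is a 'Subset n' (Vec Bool n).

memAt : {n : ℕ} → Subset n → ℕ → Bool
memAt {zero}  U i = false
memAt {suc n} U i = lookup U (i mod suc n)

arcCount : {n : ℕ} → Subset n → ℕ → ℕ → ℕ
arcCount U i zero    = 0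
arcCount U i (suc m) = arcCount U i m + (if memAt U (i + m) then 1 else 0)

NoConsecutive : {n : ℕ} → Subset n → Set
NoConsecutive {n} U =
  ∀ i → i < n → ¬ (memAt U i ≡ true × memAt U (suc i) ≡ true)

WellSpread : {n : ℕ} → Subset n → Set
WellSpread {n} U =
  ∀ i j m → i < n → j < n → 1 ≤ m → m ≤ n ∸ 1 →
  arcCount U i m ≤ arcCount U j m + 1

record Graph : Set₁ where
  field
    Vertex : Set
    Adj    : Vertex → Vertex → Set

QVertex : ℕ → ℕ → Set
QVertex n k = Σ (Subset n) (λ U → ∣ U ∣ ≡ k × NoConsecutive U × WellSpread U)

Q : ℕ → ℕ → Graph
Q n k = record
  { Vertex = QVertex n k
  ; Adj    = λ U V → proj₁ U ∩ proj₁ V ≡ ⊥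
  }

-- Graph isomorphism: a bijection on vertices (vertices are identified when
-- their underlying subsets coincide; the remaining components are proofs)
-- that preserves and reflects adjacency.
record QIso (n₁ k₁ n₂ k₂ : ℕ) : Set where
  field
    to      : QVertex n₁ k₁ → QVertex n₂ k₂
    from    : QVertex n₂ k₂ → QVertex n₁ k₁
    from∘to : ∀ x → proj₁ (from (to x)) ≡ proj₁ x
    to∘from : ∀ y → proj₁ (to (from y)) ≡ proj₁ y
    adj-to  : ∀ x y → Graph.Adj (Q n₁ k₁) x y → Graph.Adj (Q n₂ k₂) (to x) (to y)
    adj-from : ∀ x y → Graph.Adj (Q n₂ k₂) (to x) (to y) → Graph.Adj (Q n₁ k₁) x y

{-# OPTIONS --safe #-}
module Submission where

-- A subset of [n] is read as its n-periodic indicator sequence on ℕ; a vertex of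
-- Q(n,k) is then a sequence of period n with k ones per period, no two
-- consecutive ones, and window counts that differ by at most one for windows of
-- equal length.  The isomorphism keeps the sequence and only changes the period.
-- Viewing an n-periodic sequence with period ℓn is harmless, since any window
-- splits into whole periods, each holding k ones, plus a window shorter than n.
-- Conversely, in a vertex of Q(ℓn,ℓk) the windows of length n differ by at most
-- one while ℓ consecutive ones hold ℓk ones, so every one of them holds exactly
-- k; comparing the windows starting at j and j+1 then gives period n.  Since
-- both maps keep the sequence, they preserve disjointness.

open import Defs
open import Data.Bool using (Bool; true; false; if_then_else_; _∧_)
open import Data.Empty using (⊥-elim)
open import Data.Fin using (toℕ; fromℕ<)
open import Data.Fin.Properties using (toℕ-fromℕ<; fromℕ<-toℕ; toℕ<n; fromℕ<-cong)
open import Data.Fin.Subset using (Subset; ∣_∣; _∩_; ⊥)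
open import Data.Nat using (ℕ; zero; suc; _+_; _*_; _∸_; _≤_; _<_; z≤n; s≤s; s≤s⁻¹; NonZero; >-nonZero; _%_; _/_)
open import Data.Nat.DivMod using (_mod_; m≡m%n+[m/n]*n; m%n<n; [m+n]%n≡m%n; m<n⇒m%n≡m)
open import Data.Nat.Properties
open import Algebra.Properties.CommutativeSemigroup +-commutativeSemigroup using (xy∙z≈xz∙y)
open import Data.Product using (_×_; _,_; proj₁)
open import Data.Vec using (_∷_; lookup; tabulate)
open import Data.Vec.Properties using (lookup-zipWith; lookup-replicate; lookup∘tabulate; tabulate∘lookup; tabulate-cong)
open import Relation.Binary using (tri<; tri≈; tri>)
open import Relation.Binary.PropositionalEquality
open import Relation.Nullary using (¬_)

indicator : Bool → ℕ
indicator b = if b then 1 else 0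

indicator-injective : ∀ {a b} → indicator a ≡ indicator b → a ≡ b
indicator-injective {true}  {true}  _  = refl
indicator-injective {false} {false} _  = refl
indicator-injective {true}  {false} ()
indicator-injective {false} {true}  ()

count : (ℕ → Bool) → ℕ → ℕ → ℕ
count f i zero    = 0
count f i (suc m) = count f i m + indicator (f (i + m))

count-cong : ∀ {f g} → (∀ j → f j ≡ g j) → ∀ i m → count f i m ≡ count g i m
count-cong f≗g i zero    = refl
count-cong f≗g i (suc m) = cong₂ _+_ (count-cong f≗g i m) (cong indicator (f≗g (i + m)))

count-+ : ∀ f i m p → count f i (m + p) ≡ count f i m + count f (i + m) p
count-+ f i m zero    = trans (cong (count f i) (+-identityʳ m)) (sym (+-identityʳ _))
count-+ f i m (suc p) = begin
  count f i (m + suc p)                                  ≡⟨ cong (count f i) (+-suc m p) ⟩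
  count f i (m + p) + indicator (f (i + (m + p)))        ≡⟨ cong₂ _+_ (count-+ f i m p) (cong (λ x → indicator (f x)) (sym (+-assoc i m p))) ⟩
  count f i m + count f (i + m) p + indicator (f (i + m + p)) ≡⟨ +-assoc (count f i m) _ _ ⟩
  count f i m + count f (i + m) (suc p)                  ∎
  where open ≡-Reasoning

count-suc-start : ∀ f i m → count f i (suc m) ≡ indicator (f i) + count f (suc i) m
count-suc-start f i zero    = trans (cong (λ x → indicator (f x)) (+-identityʳ i)) (sym (+-identityʳ _))
count-suc-start f i (suc m) =
  trans (cong₂ _+_ (count-suc-start f i m) (cong (λ x → indicator (f x)) (+-suc i m)))
        (+-assoc (indicator (f i)) (count f (suc i) m) _)

count-∘suc : ∀ f i m → count f (suc i) m ≡ count (λ j → f (suc j)) i m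
count-∘suc f i zero    = refl
count-∘suc f i (suc m) = cong (_+ indicator (f (suc (i + m)))) (count-∘suc f i m)

Periodic : (ℕ → Bool) → ℕ → Set
Periodic f p = ∀ j → f (j + p) ≡ f j

periodic-* : ∀ {f p} → Periodic f p → ∀ q → Periodic f (q * p)
periodic-* {f} per zero    j = cong f (+-identityʳ j)
periodic-* {f} {p} per (suc q) j =
  trans (cong f (sym (+-assoc j p (q * p)))) (trans (periodic-* per q (j + p)) (per j))

periodic-reduce : ∀ {f p} .{{_ : NonZero p}} → Periodic f p → ∀ i j → f (i + j) ≡ f (i + j % p)
periodic-reduce {f} {p} per i j = begin
  f (i + j)                   ≡⟨ cong (λ x → f (i + x)) (m≡m%n+[m/n]*n j p) ⟩
  f (i + (j % p + j / p * p)) ≡⟨ cong f (+-assoc i (j % p) _) ⟨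
  f (i + j % p + j / p * p)   ≡⟨ periodic-* per (j / p) (i + j % p) ⟩
  f (i + j % p)               ∎
  where open ≡-Reasoning

count-shift-period : ∀ {f p} → Periodic f p → ∀ q i m → count f (i + q * p) m ≡ count f i m
count-shift-period per q i zero = refl
count-shift-period {f} {p} per q i (suc m) =
  cong₂ _+_ (count-shift-period per q i m)
    (cong indicator (trans (cong f (xy∙z≈xz∙y i (q * p) m)) (periodic-* per q (i + m))))

count-mod : ∀ {f p} .{{_ : NonZero p}} → Periodic f p → ∀ i m → count f i m ≡ count f (i % p) m
count-mod {f} {p} per i m =
  trans (cong (λ x → count f x m) (m≡m%n+[m/n]*n i p)) (count-shift-period per (i / p) (i % p) m)

count-rotate : ∀ {f p} → Periodic f p → ∀ i → count f i p ≡ count f 0 p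
count-rotate per zero = refl
count-rotate {f} {p} per (suc i) = trans step (count-rotate per i)
  where
  step : count f (suc i) p ≡ count f i p
  step = +-cancelˡ-≡ (indicator (f i)) _ _ (begin
    indicator (f i) + count f (suc i) p  ≡⟨ count-suc-start f i p ⟨
    count f i p + indicator (f (i + p))  ≡⟨ cong (λ b → count f i p + indicator b) (per i) ⟩
    count f i p + indicator (f i)        ≡⟨ +-comm (count f i p) _ ⟩
    indicator (f i) + count f i p        ∎)
    where open ≡-Reasoning

count-periods : ∀ {f p} → Periodic f p → ∀ q i → count f i (q * p) ≡ q * count f 0 p
count-periods per zero i = refl
count-periods {f} {p} per (suc q) i =
  trans (count-+ f i p (q * p)) (cong₂ _+_ (count-rotate per i) (count-periods per q (i + p)))

count-decompose : ∀ {f p} .{{_ : NonZero p}} → Periodic f p →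
  ∀ i m → count f i m ≡ count f i (m % p) + m / p * count f 0 p
count-decompose {f} {p} per i m =
  trans (cong (count f i) (m≡m%n+[m/n]*n m p))
    (trans (count-+ f i (m % p) (m / p * p))
      (cong (count f i (m % p) +_) (count-periods per (m / p) (i + m % p))))

periodic-spread : ∀ {f p} .{{_ : NonZero p}} → Periodic f p →
  (∀ i j r → r < p → count f i r ≤ count f j r + 1) →
  ∀ i j m → count f i m ≤ count f j m + 1
periodic-spread {f} {p} per spread i j m = begin
  count f i m                    ≡⟨ count-decompose per i m ⟩
  count f i (m % p) + t          ≤⟨ +-monoˡ-≤ t (spread i j (m % p) (m%n<n m p)) ⟩
  count f j (m % p) + 1 + t      ≡⟨ xy∙z≈xz∙y (count f j (m % p)) 1 t ⟩
  count f j (m % p) + t + 1      ≡⟨ cong (_+ 1) (count-decompose per j m) ⟨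
  count f j m + 1                ∎
  where
  t = m / p * count f 0 p
  open ≤-Reasoning

count-periods-≤ : ∀ {f n H} → (∀ a → count f a n ≤ H) → ∀ q a → count f a (q * n) ≤ q * H
count-periods-≤ h zero a = z≤n
count-periods-≤ {f} {n} h (suc q) a =
  subst (_≤ _) (sym (count-+ f a n (q * n))) (+-mono-≤ (h a) (count-periods-≤ h q (a + n)))

count-periods-≥ : ∀ {f n L} → (∀ a → L ≤ count f a n) → ∀ q a → q * L ≤ count f a (q * n)
count-periods-≥ h zero a = z≤n
count-periods-≥ {f} {n} h (suc q) a =
  subst (_ ≤_) (sym (count-+ f a n (q * n))) (+-mono-≤ (h a) (count-periods-≥ h q (a + n)))

balanced-count-constant : ∀ {f n k} q →
  (∀ a d → count f a n ≤ count f d n + 1) →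
  (∀ i → count f i (suc q * n) ≡ suc q * k) →
  ∀ i → count f i n ≡ k
balanced-count-constant {f} {n} {k} q spread total i with <-cmp (count f i n) k
... | tri≈ _ c≡k _ = c≡k
... | tri< c<k _ _ = ⊥-elim (<-irrefl (total i)
  (subst (_< suc q * k) (sym (count-+ f i n (q * n)))
    (+-mono-<-≤ c<k (count-periods-≤ (λ a → ≤-trans (spread a i) c+1≤k) q (i + n)))))
  where
  c+1≤k : count f i n + 1 ≤ k
  c+1≤k = subst (_≤ k) (+-comm 1 _) c<k
... | tri> _ _ k<c = ⊥-elim (<-irrefl (sym (total i))
  (subst (suc q * k <_) (sym (count-+ f i n (q * n)))
    (+-mono-<-≤ k<c (count-periods-≥ k≤c q (i + n)))))
  where
  k≤c : ∀ a → k ≤ count f a n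
  k≤c a = s≤s⁻¹ (subst (suc k ≤_) (+-comm (count f a n) 1) (≤-trans k<c (spread i a)))

constant-count⇒periodic : ∀ {f n k} → (∀ i → count f i n ≡ k) → Periodic f n
constant-count⇒periodic {f} {n} {k} c j = indicator-injective (+-cancelˡ-≡ k _ _ (begin
  k + indicator (f (j + n))            ≡⟨ cong (_+ indicator (f (j + n))) (c j) ⟨
  count f j (suc n)                    ≡⟨ count-suc-start f j n ⟩
  indicator (f j) + count f (suc j) n  ≡⟨ cong (indicator (f j) +_) (c (suc j)) ⟩
  indicator (f j) + k                  ≡⟨ +-comm (indicator (f j)) k ⟩
  k + indicator (f j)                  ∎))
  where open ≡-Reasoning

record IsQSequence (n k : ℕ) (f : ℕ → Bool) : Set where
  field
    periodic      : Periodic f n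
    total         : count f 0 n ≡ k
    noConsecutive : ∀ i → ¬ (f i ≡ true × f (suc i) ≡ true)
    spread        : ∀ i j m → m < n → count f i m ≤ count f j m + 1

isQSequence-repeat : ∀ ℓ {n k f} .{{_ : NonZero n}} → IsQSequence n k f → IsQSequence (ℓ * n) (ℓ * k) f
isQSequence-repeat ℓ s = record
  { periodic      = periodic-* periodic ℓ
  ; total         = trans (count-periods periodic ℓ 0) (cong (ℓ *_) total)
  ; noConsecutive = noConsecutive
  ; spread        = λ i j m _ → periodic-spread periodic spread i j m
  }
  where open IsQSequence s

isQSequence-fold : ∀ ℓ {n k f} → n < ℓ * n → IsQSequence (ℓ * n) (ℓ * k) f → IsQSequence n k f
isQSequence-fold zero    ()
isQSequence-fold (suc q) {n} {k} {f} n<N s = record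
  { periodic      = constant-count⇒periodic count≡k
  ; total         = count≡k 0
  ; noConsecutive = noConsecutive
  ; spread        = λ i j m m<n → spread i j m (<-trans m<n n<N)
  }
  where
  open IsQSequence s
  count≡k : ∀ i → count f i n ≡ k
  count≡k = balanced-count-constant {f} {n} q (λ a d → spread a d n n<N)
                                      (λ i → trans (count-rotate periodic i) total)

fromSeq : (N : ℕ) → (ℕ → Bool) → Subset N
fromSeq N f = tabulate (λ x → f (toℕ x))

memAt-lookup : ∀ {N} (U : Subset N) {j} (j<N : j < N) → memAt U j ≡ lookup U (fromℕ< j<N)
memAt-lookup {suc _} U j<N = cong (lookup U) (fromℕ<-cong _ _ (m<n⇒m%n≡m j<N) _ _)

memAt-fromSeq : ∀ N f {j} → j < N → memAt (fromSeq N f) j ≡ f j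
memAt-fromSeq N f j<N =
  trans (memAt-lookup _ j<N) (trans (lookup∘tabulate _ (fromℕ< j<N)) (cong f (toℕ-fromℕ< j<N)))

memAt-injective : ∀ {N} {U V : Subset N} → (∀ {j} → j < N → memAt U j ≡ memAt V j) → U ≡ V
memAt-injective {U = U} {V} U≗V =
  trans (sym (tabulate∘lookup U)) (trans (tabulate-cong lookup-≡) (tabulate∘lookup V))
  where
  lookup-≡ : ∀ x → lookup U x ≡ lookup V x
  lookup-≡ x = begin
    lookup U x                         ≡⟨ cong (lookup U) (fromℕ<-toℕ x (toℕ<n x)) ⟨
    lookup U (fromℕ< (toℕ<n x))        ≡⟨ memAt-lookup U (toℕ<n x) ⟨
    memAt U (toℕ x)                    ≡⟨ U≗V (toℕ<n x) ⟩
    memAt V (toℕ x)                    ≡⟨ memAt-lookup V (toℕ<n x) ⟩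
    lookup V (fromℕ< (toℕ<n x))        ≡⟨ cong (lookup V) (fromℕ<-toℕ x (toℕ<n x)) ⟩
    lookup V x                         ∎
    where open ≡-Reasoning

memAt-periodic : ∀ {N} (U : Subset N) → Periodic (memAt U) N
memAt-periodic {zero}  U j = refl
memAt-periodic {suc N} U j = cong (lookup U) (fromℕ<-cong _ _ ([m+n]%n≡m%n j (suc N)) _ _)

memAt-fromSeq-periodic : ∀ {N f} .{{_ : NonZero N}} → Periodic f N → ∀ j → memAt (fromSeq N f) j ≡ f j
memAt-fromSeq-periodic {N} {f} per j =
  trans (periodic-reduce (memAt-periodic (fromSeq N f)) 0 j)
    (trans (memAt-fromSeq N f (m%n<n j N)) (sym (periodic-reduce per 0 j)))

∣∣-∷ : ∀ {N} b (U : Subset N) → ∣ b ∷ U ∣ ≡ indicator b + ∣ U ∣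
∣∣-∷ true  U = refl
∣∣-∷ false U = refl

∣fromSeq∣ : ∀ N f → ∣ fromSeq N f ∣ ≡ count f 0 N
∣fromSeq∣ zero    f = refl
∣fromSeq∣ (suc N) f = begin
  ∣ fromSeq (suc N) f ∣                              ≡⟨ ∣∣-∷ (f 0) (fromSeq N (λ j → f (suc j))) ⟩
  indicator (f 0) + ∣ fromSeq N (λ j → f (suc j)) ∣  ≡⟨ cong (indicator (f 0) +_) (∣fromSeq∣ N (λ j → f (suc j))) ⟩
  indicator (f 0) + count (λ j → f (suc j)) 0 N      ≡⟨ cong (indicator (f 0) +_) (count-∘suc f 0 N) ⟨
  indicator (f 0) + count f 1 N                      ≡⟨ count-suc-start f 0 N ⟨
  count f 0 (suc N)                                  ∎
  where open ≡-Reasoning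

∣∣≡count : ∀ {N} (U : Subset N) → ∣ U ∣ ≡ count (memAt U) 0 N
∣∣≡count {N} U = trans (cong ∣_∣ (sym fromSeq-memAt)) (∣fromSeq∣ N (memAt U))
  where
  fromSeq-memAt : fromSeq N (memAt U) ≡ U
  fromSeq-memAt = memAt-injective (memAt-fromSeq N (memAt U))

arcCount≡count : ∀ {N} (U : Subset N) i m → arcCount U i m ≡ count (memAt U) i m
arcCount≡count U i zero    = refl
arcCount≡count U i (suc m) = cong (_+ indicator (memAt U (i + m))) (arcCount≡count U i m)

memAt-∩ : ∀ {N} (A B : Subset N) j → memAt (A ∩ B) j ≡ memAt A j ∧ memAt B j
memAt-∩ {zero}  A B j = refl
memAt-∩ {suc N} A B j = lookup-zipWith _∧_ _ A B

memAt-⊥ : ∀ {N} j → memAt {N} ⊥ j ≡ false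
memAt-⊥ {zero}  j = refl
memAt-⊥ {suc N} j = lookup-replicate (j mod suc N) false

∩≡⊥-cong : ∀ {N M} {A B : Subset N} {A′ B′ : Subset M} →
  (∀ j → memAt A j ≡ memAt A′ j) → (∀ j → memAt B j ≡ memAt B′ j) →
  A ∩ B ≡ ⊥ → A′ ∩ B′ ≡ ⊥
∩≡⊥-cong {N} {M} {A} {B} {A′} {B′} A≗A′ B≗B′ A∩B≡⊥ = memAt-injective λ {j} _ → begin
  memAt (A′ ∩ B′) j      ≡⟨ memAt-∩ A′ B′ j ⟩
  memAt A′ j ∧ memAt B′ j ≡⟨ cong₂ _∧_ (A≗A′ j) (B≗B′ j) ⟨
  memAt A j ∧ memAt B j  ≡⟨ memAt-∩ A B j ⟨
  memAt (A ∩ B) j        ≡⟨ cong (λ X → memAt X j) A∩B≡⊥ ⟩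
  memAt {N} ⊥ j          ≡⟨ memAt-⊥ {N} j ⟩
  false                  ≡⟨ memAt-⊥ {M} j ⟨
  memAt {M} ⊥ j          ∎
  where open ≡-Reasoning

<⇒≤∸1 : ∀ {m n} → m < n → m ≤ n ∸ 1
<⇒≤∸1 {n = suc n} (s≤s m≤n) = m≤n

≤∸1⇒< : ∀ {m n} → 1 ≤ m → m ≤ n ∸ 1 → m < n
≤∸1⇒< {n = zero}  (s≤s z≤n) ()
≤∸1⇒< {n = suc n} _         m≤n = s≤s m≤n

vertex⇒isQSequence : ∀ {N K} .{{_ : NonZero N}} (x : QVertex N K) → IsQSequence N K (memAt (proj₁ x))
vertex⇒isQSequence {N} (U , ∣U∣≡K , noConsecutiveU , wellSpreadU) = record
  { periodic      = per
  ; total         = trans (sym (∣∣≡count U)) ∣U∣≡K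
  ; noConsecutive = noConsecutive
  ; spread        = spread
  }
  where
  per = memAt-periodic U

  noConsecutive : ∀ i → ¬ (memAt U i ≡ true × memAt U (suc i) ≡ true)
  noConsecutive i (Ui , Usuci) = noConsecutiveU (i % N) (m%n<n i N)
    (trans (sym (periodic-reduce per 0 i)) Ui , trans (sym (periodic-reduce per 1 i)) Usuci)

  arc-mod : ∀ i m → arcCount U (i % N) m ≡ count (memAt U) i m
  arc-mod i m = trans (arcCount≡count U (i % N) m) (sym (count-mod per i m))

  spread : ∀ i j m → m < N → count (memAt U) i m ≤ count (memAt U) j m + 1
  spread i j zero    _   = z≤n
  spread i j (suc m) m<N = subst₂ (λ a b → a ≤ b + 1) (arc-mod i (suc m)) (arc-mod j (suc m))
    (wellSpreadU (i % N) (j % N) (suc m) (m%n<n i N) (m%n<n j N) (s≤s z≤n) (<⇒≤∸1 m<N))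

isQSequence⇒vertex : ∀ {N K f} .{{_ : NonZero N}} → IsQSequence N K f → QVertex N K
isQSequence⇒vertex {N} {K} {f} s = fromSeq N f , ∣U∣≡K , noConsecutiveU , wellSpreadU
  where
  open IsQSequence s
  memAt≡f = memAt-fromSeq-periodic periodic

  arc≡count : ∀ i m → arcCount (fromSeq N f) i m ≡ count f i m
  arc≡count i m = trans (arcCount≡count _ i m) (count-cong memAt≡f i m)

  ∣U∣≡K : ∣ fromSeq N f ∣ ≡ K
  ∣U∣≡K = trans (∣fromSeq∣ N f) total

  noConsecutiveU : NoConsecutive (fromSeq N f)
  noConsecutiveU i _ (Ui , Usuci) =
    noConsecutive i (trans (sym (memAt≡f i)) Ui , trans (sym (memAt≡f (suc i))) Usuci)

  wellSpreadU : WellSpread (fromSeq N f)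
  wellSpreadU i j m _ _ 1≤m m≤N∸1 = subst₂ (λ a b → a ≤ b + 1) (sym (arc≡count i m)) (sym (arc≡count j m))
    (spread i j m (≤∸1⇒< 1≤m m≤N∸1))

module _ {N K N′ K′} .{{_ : NonZero N}} .{{_ : NonZero N′}}
         (convert : ∀ {f} → IsQSequence N K f → IsQSequence N′ K′ f) where

  transport : QVertex N K → QVertex N′ K′
  transport x = isQSequence⇒vertex (convert (vertex⇒isQSequence x))

  memAt-transport : ∀ x j → memAt (proj₁ (transport x)) j ≡ memAt (proj₁ x) j
  memAt-transport x = memAt-fromSeq-periodic (IsQSequence.periodic (convert (vertex⇒isQSequence x)))

qIso : ∀ {n k n′ k′} .{{_ : NonZero n}} .{{_ : NonZero n′}} →
  (∀ {f} → IsQSequence n k f → IsQSequence n′ k′ f) →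
  (∀ {f} → IsQSequence n′ k′ f → IsQSequence n k f) →
  QIso n k n′ k′
qIso there back = record
  { to       = transport there
  ; from     = transport back
  ; from∘to  = λ x → memAt-injective λ {j} _ →
      trans (memAt-transport back (transport there x) j) (memAt-transport there x j)
  ; to∘from  = λ y → memAt-injective λ {j} _ →
      trans (memAt-transport there (transport back y) j) (memAt-transport back y j)
  ; adj-to   = λ x y → ∩≡⊥-cong (λ j → sym (memAt-transport there x j)) (λ j → sym (memAt-transport there y j))
  ; adj-from = λ x y → ∩≡⊥-cong (memAt-transport there x) (memAt-transport there y)
  }

proposition8 : (n k ℓ : ℕ) → 1 ≤ k → 2 * k ≤ n → 2 ≤ ℓ →
    QIso n k (ℓ * n) (ℓ * k)
proposition8 n k ℓ 1≤k 2k≤n 2≤ℓ = qIso (isQSequence-repeat ℓ) (isQSequence-fold ℓ n<ℓn)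
  where
  instance
    n≢0 : NonZero n
    n≢0 = >-nonZero (≤-trans 1≤k (≤-trans (m≤m+n k (k + 0)) 2k≤n))
    ℓn≢0 : NonZero (ℓ * n)
    ℓn≢0 = m*n≢0 ℓ n {{>-nonZero (≤-trans (s≤s z≤n) 2≤ℓ)}}

  n<ℓn : n < ℓ * n
  n<ℓn = subst (n <_) (*-comm n ℓ) (m<m*n n ℓ 2≤ℓ)
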